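{- Define numbers $a_{n,m}$ for $n,m\in\mathbb N_0$ by $a_{n,0}=1$ for all $n\ge0$, $a_{0,m}=0$ for all $m>0$, and for $n,m>0$ recursively $a_{n,m}=(n-2(m-1))\,a_{n-1,m-1}+a_{n-1,m}$. Then: (i) $a_{n,1}=\frac12 n(n+1)$; (ii) $a_{n,2}=\frac18 n(n+1)(n-1)(n-2)$; (iii) $a_{n,m}=0$ for all $m>\lfloor\frac{n+1}{2}\rfloor$; (iv) $a_{2\nu-1,\nu}=a_{2(\nu-1),\nu-1}$ (for $\nu\ge1$). -}

module Defs where

open import Data.Nat using (ℕ; zero; suc)
import Data.Nat as ℕ
open import Data.Integer using (ℤ; +_; _-_; _*_; _+_)

-- Values in ℤ since the coefficient n - 2(m-1) may be negative.
-- a_{n,0} = 1;  a_{0,m} = 0 (m > 0);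
-- a_{n,m} = (n - 2(m-1)) a_{n-1,m-1} + a_{n-1,m}  (n,m > 0).
a : ℕ → ℕ → ℤ
a n       zero    = + 1
a zero    (suc m) = + 0
a (suc n) (suc m) = (+ suc n - + (2 ℕ.* m)) * a n m + a n (suc m)

{-# OPTIONS --safe #-}
-- For (i) and (ii)
-- the closed forms of the previous row are substituted and the step is a
-- polynomial identity. For (iii), if 2m > n + 2 then a_{n,m} = 0 by induction,
-- and so is a_{n,m-1} unless 2(m-1) = n + 1, which is exactly where its
-- coefficient n + 1 - 2(m-1) vanishes. Part (iv) is the recurrence just below
-- that boundary: the coefficient is 1 and the second summand vanishes by (iii).
module Submission where

open import Defs
open import Data.Nat using (ℕ; _≤_; _<_; _∸_; _/_; zero; suc)
import Data.Nat as ℕ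
import Data.Nat.Properties as NP
open import Data.Nat.DivMod using (m*n/n≡m; /-monoˡ-≤)
open import Data.Integer using (ℤ; +_; _-_; _*_; _+_)
import Data.Integer.Properties as ZP
open import Data.Integer.Tactic.RingSolver using (solve-∀)
open import Data.Product using (_×_; _,_)
open import Data.Sum using ([_,_]′)
open import Relation.Binary.PropositionalEquality
open ≡-Reasoning

2*a[n,1]≡n[n+1] : (n : ℕ) → + 2 * a n 1 ≡ + n * (+ n + + 1)
2*a[n,1]≡n[n+1] zero    = refl
2*a[n,1]≡n[n+1] (suc n) = begin
  + 2 * ((+ 1 + + n - + 0) * + 1 + a n 1)  ≡⟨ unfold (+ n) (a n 1) ⟩
  + 2 * (+ 1 + + n) + + 2 * a n 1          ≡⟨ cong (_+_ (+ 2 * (+ 1 + + n))) (2*a[n,1]≡n[n+1] n) ⟩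
  + 2 * (+ 1 + + n) + + n * (+ n + + 1)    ≡⟨ close (+ n) ⟩
  (+ 1 + + n) * ((+ 1 + + n) + + 1)        ∎
  where
  unfold : ∀ N A → + 2 * ((+ 1 + N - + 0) * + 1 + A) ≡ + 2 * (+ 1 + N) + + 2 * A
  unfold = solve-∀
  close : ∀ N → + 2 * (+ 1 + N) + N * (N + + 1) ≡ (+ 1 + N) * ((+ 1 + N) + + 1)
  close = solve-∀

8*a[n,2]≡n[n+1][n-1][n-2] :
  (n : ℕ) → + 8 * a n 2 ≡ + n * (+ n + + 1) * (+ n - + 1) * (+ n - + 2)
8*a[n,2]≡n[n+1][n-1][n-2] zero    = refl
8*a[n,2]≡n[n+1][n-1][n-2] (suc n) = begin
  + 8 * ((+ 1 + + n - + 2) * a n 1 + a n 2)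
    ≡⟨ unfold (+ n) (a n 1) (a n 2) ⟩
  + 4 * (+ n - + 1) * (+ 2 * a n 1) + + 8 * a n 2
    ≡⟨ cong₂ (λ x y → + 4 * (+ n - + 1) * x + y) (2*a[n,1]≡n[n+1] n) (8*a[n,2]≡n[n+1][n-1][n-2] n) ⟩
  + 4 * (+ n - + 1) * (+ n * (+ n + + 1)) + + n * (+ n + + 1) * (+ n - + 1) * (+ n - + 2)
    ≡⟨ close (+ n) ⟩
  (+ 1 + + n) * ((+ 1 + + n) + + 1) * ((+ 1 + + n) - + 1) * ((+ 1 + + n) - + 2)
    ∎
  where
  unfold : ∀ N A B → + 8 * ((+ 1 + N - + 2) * A + B) ≡ + 4 * (N - + 1) * (+ 2 * A) + + 8 * B
  unfold = solve-∀
  close : ∀ N → + 4 * (N - + 1) * (N * (N + + 1)) + N * (N + + 1) * (N - + 1) * (N - + 2)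
              ≡ (+ 1 + N) * ((+ 1 + N) + + 1) * ((+ 1 + N) - + 1) * ((+ 1 + N) - + 2)
  close = solve-∀

1+n<2m⇒a[n,m]≡0 : ∀ n m → suc n < 2 ℕ.* m → a n m ≡ + 0
1+n<2m⇒a[n,m]≡0 zero    zero    ()
1+n<2m⇒a[n,m]≡0 zero    (suc m) _ = refl
1+n<2m⇒a[n,m]≡0 (suc n) zero    ()
1+n<2m⇒a[n,m]≡0 (suc n) (suc m) 2+n<2+2m =
  [ inside , on-boundary ]′ (NP.m≤n⇒m<n∨m≡n 1+n≤2m)
  where
  c : ℤ
  c = + suc n - + (2 ℕ.* m)
  1+n≤2m : suc n ≤ 2 ℕ.* m
  1+n≤2m = NP.+-cancelˡ-≤ 2 _ _ (NP.≤-trans 2+n<2+2m (NP.≤-reflexive (NP.*-suc 2 m)))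
  a[n,1+m]≡0 : a n (suc m) ≡ + 0
  a[n,1+m]≡0 = 1+n<2m⇒a[n,m]≡0 n (suc m) (NP.<-trans (NP.n<1+n (suc n)) 2+n<2+2m)
  inside : suc n < 2 ℕ.* m → c * a n m + a n (suc m) ≡ + 0
  inside 1+n<2m = begin
    c * a n m + a n (suc m)  ≡⟨ cong₂ (λ x y → c * x + y) (1+n<2m⇒a[n,m]≡0 n m 1+n<2m) a[n,1+m]≡0 ⟩
    c * + 0 + + 0            ≡⟨ cong (_+ + 0) (ZP.*-zeroʳ c) ⟩
    + 0                      ∎
  on-boundary : suc n ≡ 2 ℕ.* m → c * a n m + a n (suc m) ≡ + 0
  on-boundary 1+n≡2m =
    cong₂ (λ x y → x * a n m + y) (ZP.i≡j⇒i-j≡0 (cong +_ 1+n≡2m)) a[n,1+m]≡0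

m/o<n⇒m<n*o : ∀ m n o .{{_ : ℕ.NonZero o}} → m / o < n → m < n ℕ.* o
m/o<n⇒m<n*o m n o m/o<n = NP.≰⇒> λ n*o≤m → NP.<⇒≱ m/o<n (n≤m/o n*o≤m)
  where
  n≤m/o : n ℕ.* o ≤ m → n ≤ m / o
  n≤m/o n*o≤m = NP.≤-trans (NP.≤-reflexive (sym (m*n/n≡m n o))) (/-monoˡ-≤ o n*o≤m)

a[1+2k,1+k]≡a[2k,k] : ∀ k → a (suc (2 ℕ.* k)) (suc k) ≡ a (2 ℕ.* k) k
a[1+2k,1+k]≡a[2k,k] k = begin
  (+ suc (2 ℕ.* k) - + (2 ℕ.* k)) * a (2 ℕ.* k) k + a (2 ℕ.* k) (suc k)
    ≡⟨ cong₂ (λ x y → x * a (2 ℕ.* k) k + y) (1+K-K≡1 (+ (2 ℕ.* k))) a[2k,1+k]≡0 ⟩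
  + 1 * a (2 ℕ.* k) k + + 0
    ≡⟨ trans (ZP.+-identityʳ _) (ZP.*-identityˡ _) ⟩
  a (2 ℕ.* k) k
    ∎
  where
  1+K-K≡1 : ∀ K → + 1 + K - K ≡ + 1
  1+K-K≡1 = solve-∀
  a[2k,1+k]≡0 : a (2 ℕ.* k) (suc k) ≡ + 0
  a[2k,1+k]≡0 = 1+n<2m⇒a[n,m]≡0 (2 ℕ.* k) (suc k) (NP.≤-reflexive (sym (NP.*-suc 2 k)))

proposition5p3 : ((n : ℕ) → + 2 * a n 1 ≡ + n * (+ n Data.Integer.+ + 1))
    × ((n : ℕ) → + 8 * a n 2 ≡ + n * (+ n Data.Integer.+ + 1) * (+ n - + 1) * (+ n - + 2))
    × ((n m : ℕ) → (n ℕ.+ 1) / 2 < m → a n m ≡ + 0)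
    × ((ν : ℕ) → 1 ≤ ν → a (2 ℕ.* ν ∸ 1) ν ≡ a (2 ℕ.* (ν ∸ 1)) (ν ∸ 1))
proposition5p3 =
    2*a[n,1]≡n[n+1]
  , 8*a[n,2]≡n[n+1][n-1][n-2]
  , vanishing
  , diagonal
  where
  vanishing : (n m : ℕ) → (n ℕ.+ 1) / 2 < m → a n m ≡ + 0
  vanishing n m [n+1]/2<m = 1+n<2m⇒a[n,m]≡0 n m
    (subst₂ _<_ (NP.+-comm n 1) (NP.*-comm m 2) (m/o<n⇒m<n*o (n ℕ.+ 1) m 2 [n+1]/2<m))
  diagonal : (ν : ℕ) → 1 ≤ ν → a (2 ℕ.* ν ∸ 1) ν ≡ a (2 ℕ.* (ν ∸ 1)) (ν ∸ 1)
  diagonal (suc k) _ = begin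
    a (2 ℕ.* suc k ∸ 1) (suc k)  ≡⟨ cong (λ j → a (j ∸ 1) (suc k)) (NP.*-suc 2 k) ⟩
    a (suc (2 ℕ.* k)) (suc k)    ≡⟨ a[1+2k,1+k]≡a[2k,k] k ⟩
    a (2 ℕ.* k) k                ∎
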